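{- Let $W$ be a poset, let $\gamma=(\gamma_1,\gamma_\otimes,\gamma_{\backslash},\gamma_{/}):W\to T_{\mathrm{RL}}W$ be a $T_{\mathrm{RL}}$-coalgebra, and let $v$ assign an up-set of $W$ to each propositional variable. Define, for $w\in W$: - $\gamma_\otimes^{\downarrow\downarrow}(w)=\{(x,y)\mid \exists (x',y')\in\gamma_\otimes(w),\ x\le x',\ y\le y'\}$ - $\gamma_{\backslash}^{\downarrow\uparrow}(w)=\{(x,y)\mid \exists (x',y')\in\gamma_{\backslash}(w),\ x\le x',\ y'\le y\}$ - $\gamma_{/}^{\uparrow\downarrow}(w)=\{(x,y)\mid \exists (x',y')\in\gamma_{/}(w),\ x'\le x,\ y\le y'\}$ Let $\hat\gamma=(\gamma_1,\gamma_\otimes^{\downarrow\downarrow},\gamma_{\backslash}^{\downarrow\uparrow},\gamma_{/}^{\uparrow\downarrow})$. Then for every formula $a$ and every $w\in W$: $w\in[\![a]\!]_{\gamma,v}$ iff $w\in[\![a]\!]_{\hat\gamma,v}$.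
   Context: Formulas are terms built from propositional variables using $\wedge,\vee$ (and $\top,\bot$ if desired), a constant $I$, and binary connectives $\otimes,\backslash,/$. $W^{\mathrm{op}}$ is the opposite order, and products are ordered componentwise. A subset $U$ is convex if $x,z\in U$ and $x\le y\le z$ imply $y\in U$. $\mathsf{P}_c(W)$ is the set of convex subsets with the Egli–Milner order: $U\le U'$ iff every $u\in U$ has some $u'\in U'$ with $u\le u'$, and every $u'\in U'$ has some $u\in U$ with $u\le u'$. $\mathbf{2}=\{0,1\}$ is ordered by $1\le0$. $T_{\mathrm{RL}}W=\mathbf{2}\times\mathsf{P}_c(W\times W)\times\mathsf{P}_c(W^{\mathrm{op}}\times W)\times\mathsf{P}_c(W\times W^{\mathrm{op}})$. A $T_{\mathrm{RL}}$-coalgebra is a monotone map $W\to T_{\mathrm{RL}}W$. For any quadruple $\rho=(\rho_1,\rho_2,\rho_3,\rho_4)$ of maps with $\rho_1:W\to\mathbf{2}$ and $\rho_2,\rho_3,\rho_4:W\to$ subsets of $W\times W$, the interpretation $[\![\cdot]\!]_{\rho,v}\subseteq W$ is defined by recursion on formulas: - Variables by $v$; $\wedge,\vee,\top,\bot$ as intersection, union, $W$, $\emptyset$. - $w\in[\![I]\!]$ iff $\rho_1(w)=0$. - $w\in[\![a\otimes b]\!]$ iff there is $(x,y)\in\rho_2(w)$ with $x\in[\![a]\!]$ and $y\in[\![b]\!]$. - $w\in[\![a\backslash c]\!]$ iff for all $(x,y)\in\rho_3(w)$, $x\in[\![a]\!]$ implies $y\in[\![c]\!]$. - $w\in[\![c/b]\!]$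 iff for all $(x,y)\in\rho_4(w)$, $y\in[\![b]\!]$ implies $x\in[\![c]\!]$. -}

module Defs where

open import Level using (Level; _⊔_)
open import Data.Nat using (ℕ)
open import Data.Product using (_×_; _,_; Σ; ∃)
open import Data.Sum using (_⊎_)
open import Data.Unit.Polymorphic using (⊤)
open import Data.Empty.Polymorphic using (⊥)
open import Relation.Binary.PropositionalEquality using (_≡_)
open import Relation.Binary.Bundles using (Poset)

data Two : Set where
  zero one : Two

data _≤₂_ : Two → Two → Set where
  refl₀ : zero ≤₂ zero
  refl₁ : one ≤₂ one
  one≤zero : one ≤₂ zero

data Fm : Set where
  var   : ℕ → Fm
  _∧ᶠ_  : Fm → Fm → Fm
  _∨ᶠ_  : Fm → Fm → Fm
  ⊤ᶠ ⊥ᶠ : Fm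
  Iᶠ    : Fm
  _⊗ᶠ_  : Fm → Fm → Fm
  _＼ᶠ_  : Fm → Fm → Fm
  _／ᶠ_  : Fm → Fm → Fm

module _ {a r p : Level} {A : Set a} (R : A → A → Set r) where

  Convex : (A → Set p) → Set (a ⊔ r ⊔ p)
  Convex U = ∀ {x y z} → U x → U z → R x y → R y z → U y

  EgliMilner : (A → Set p) → (A → Set p) → Set (a ⊔ r ⊔ p)
  EgliMilner U U' =
    (∀ u → U u → Σ A λ u' → U' u' × R u u') ×
    (∀ u' → U' u' → Σ A λ u → U u × R u u')

module _ {c ℓ₁ ℓ₂ : Level} (P : Poset c ℓ₁ ℓ₂) where
  open Poset P renaming (Carrier to W)

  _≤WW_ : W × W → W × W → Set ℓ₂
  (x , y) ≤WW (x' , y') = (x ≤ x') × (y ≤ y')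

  _≤oW_ : W × W → W × W → Set ℓ₂
  (x , y) ≤oW (x' , y') = (x' ≤ x) × (y ≤ y')

  _≤Wo_ : W × W → W × W → Set ℓ₂
  (x , y) ≤Wo (x' , y') = (x ≤ x') × (y' ≤ y)

  UpSet : {ℓ : Level} → (W → Set ℓ) → Set (c ⊔ ℓ₂ ⊔ ℓ)
  UpSet U = ∀ {x y} → x ≤ y → U x → U y

  record Quad (ℓ : Level) : Set (c Level.⊔ Level.suc ℓ) where
    field
      ρ₁ : W → Two
      ρ₂ ρ₃ ρ₄ : W → (W × W → Set ℓ)

  -- A T_RL-coalgebra: a monotone map W → 2 × P_c(W×W) × P_c(W^op×W) × P_c(W×W^op).
  record Coalg (ℓ : Level) : Set (c ⊔ ℓ₂ ⊔ Level.suc ℓ) where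
    field
      γ₁ : W → Two
      γ⊗ γ＼ γ／ : W → (W × W → Set ℓ)
      convex⊗ : ∀ w → Convex _≤WW_ (γ⊗ w)
      convex＼ : ∀ w → Convex _≤oW_ (γ＼ w)
      convex／ : ∀ w → Convex _≤Wo_ (γ／ w)
      mono₁ : ∀ {w w'} → w ≤ w' → γ₁ w ≤₂ γ₁ w'
      mono⊗ : ∀ {w w'} → w ≤ w' → EgliMilner _≤WW_ (γ⊗ w) (γ⊗ w')
      mono＼ : ∀ {w w'} → w ≤ w' → EgliMilner _≤oW_ (γ＼ w) (γ＼ w')
      mono／ : ∀ {w w'} → w ≤ w' → EgliMilner _≤Wo_ (γ／ w) (γ／ w')

    quad : Quad ℓ
    quad = record { ρ₁ = γ₁ ; ρ₂ = γ⊗ ; ρ₃ = γ＼ ; ρ₄ = γ／ }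

    quadHat : Quad (c ⊔ ℓ₂ ⊔ ℓ)
    quadHat = record
      { ρ₁ = γ₁
      ; ρ₂ = λ w xy → let (x , y) = xy in
               Σ (W × W) λ x'y' → let (x' , y') = x'y' in γ⊗ w (x' , y') × x ≤ x' × y ≤ y'
      ; ρ₃ = λ w xy → let (x , y) = xy in
               Σ (W × W) λ x'y' → let (x' , y') = x'y' in γ＼ w (x' , y') × x ≤ x' × y' ≤ y
      ; ρ₄ = λ w xy → let (x , y) = xy in
               Σ (W × W) λ x'y' → let (x' , y') = x'y' in γ／ w (x' , y') × x' ≤ x × y ≤ y'
      }

  ⟦_⟧ : {ℓ ℓv : Level} → Fm → Quad ℓ → (ℕ → W → Set ℓv) → W → Set (c ⊔ ℓ ⊔ ℓv)
  ⟦_⟧ {ℓ} {ℓv} (var p) ρ v w = Level.Lift (c ⊔ ℓ) (v p w)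
  ⟦ a ∧ᶠ b ⟧ ρ v w = ⟦ a ⟧ ρ v w × ⟦ b ⟧ ρ v w
  ⟦ a ∨ᶠ b ⟧ ρ v w = ⟦ a ⟧ ρ v w ⊎ ⟦ b ⟧ ρ v w
  ⟦ ⊤ᶠ ⟧ ρ v w = ⊤
  ⟦ ⊥ᶠ ⟧ ρ v w = ⊥
  ⟦_⟧ {ℓ} {ℓv} Iᶠ ρ v w = Level.Lift (c ⊔ ℓ ⊔ ℓv) (Quad.ρ₁ ρ w ≡ zero)
  ⟦ a ⊗ᶠ b ⟧ ρ v w =
    Σ W λ x → Σ W λ y → Quad.ρ₂ ρ w (x , y) × ⟦ a ⟧ ρ v x × ⟦ b ⟧ ρ v y
  ⟦ a ＼ᶠ c' ⟧ ρ v w =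
    ∀ x y → Quad.ρ₃ ρ w (x , y) → ⟦ a ⟧ ρ v x → ⟦ c' ⟧ ρ v y
  ⟦ c' ／ᶠ b ⟧ ρ v w =
    ∀ x y → Quad.ρ₄ ρ w (x , y) → ⟦ b ⟧ ρ v y → ⟦ c' ⟧ ρ v x

-- The proof has two ingredients.
--  * Persistence: for a monotone γ and an up-set valuation every truth set
--    ⟦ a ⟧_γ is an up-set.  The Egli–Milner monotonicity supplies exactly the
--    half that is needed: its forth half for the diamond-like ⊗, its back half
--    for the box-like residuals ＼ and ／, and the order 1 ≤ 0 on 2 for I.
--  * Transfer: the semantic clause of ⊗ (resp. ＼, ／) over a relation R and
--    over its closure R^{↓↓} (resp. R^{↓↑}, R^{↑↓}) agree, provided the argument
--    sets on the R side are up-sets and are pointwise equivalent to those on the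
--    closure side.  One direction uses R ⊆ closure (reflexivity), the other one
--    pushes a witness of the closure back to R using the up-set property.

module Submission where

open import Defs
open import Level using (Level; lift; lower)
open import Data.Nat using (ℕ)
open import Data.Product using (_×_; _,_; Σ; proj₁; proj₂)
open import Data.Product.Function.NonDependent.Propositional using (_×-⇔_)
open import Data.Sum using (inj₁; inj₂)
open import Data.Sum.Function.Propositional using (_⊎-⇔_)
open import Function.Bundles using (_⇔_; mk⇔; Equivalence)
open import Relation.Binary.Bundles using (Poset)
open import Relation.Binary.PropositionalEquality using (_≡_; refl; subst)

open Equivalence using (to; from)

zero-top : ∀ {t} → zero ≤₂ t → t ≡ zero
zero-top refl₀ = refl

module _ {c ℓ₁ ℓ₂ : Level} (P : Poset c ℓ₁ ℓ₂) where
  open Poset P renaming (Carrier to W; refl to ≤-refl)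

  _≐_ : {a b : Level} → (W → Set a) → (W → Set b) → Set _
  A ≐ A' = ∀ x → A x ⇔ A' x

  Diamond : {r a b : Level} → (W × W → Set r) → (W → Set a) → (W → Set b) → Set _
  Diamond R A B = Σ W λ x → Σ W λ y → R (x , y) × A x × B y

  BoxL : {r a b : Level} → (W × W → Set r) → (W → Set a) → (W → Set b) → Set _
  BoxL R A B = ∀ x y → R (x , y) → A x → B y

  BoxR : {r a b : Level} → (W × W → Set r) → (W → Set a) → (W → Set b) → Set _
  BoxR R B C = ∀ x y → R (x , y) → B y → C x

  _↓↓ : {r : Level} → (W × W → Set r) → (W × W → Set _)
  (R ↓↓) (x , y) = Σ (W × W) λ (x' , y') → R (x' , y') × x ≤ x' × y ≤ y'

  _↓↑ : {r : Level} → (W × W → Set r) → (W × W → Set _)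
  (R ↓↑) (x , y) = Σ (W × W) λ (x' , y') → R (x' , y') × x ≤ x' × y' ≤ y

  _↑↓ : {r : Level} → (W × W → Set r) → (W × W → Set _)
  (R ↑↓) (x , y) = Σ (W × W) λ (x' , y') → R (x' , y') × x' ≤ x × y ≤ y'

  module _ {r : Level} (R : W → W × W → Set r) where

    diamond-up : {a b : Level} {A : W → Set a} {B : W → Set b} →
      (∀ {w w'} → w ≤ w' → ∀ u → R w u → Σ (W × W) λ u' → R w' u' × _≤WW_ P u u') →
      UpSet P A → UpSet P B → UpSet P (λ w → Diamond (R w) A B)
    diamond-up forth A-up B-up w≤w' (x , y , xyR , Ax , By)
      with forth w≤w' (x , y) xyR
    ... | (x' , y') , x'y'R , x≤x' , y≤y' = x' , y' , x'y'R , A-up x≤x' Ax , B-up y≤y' By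

    boxL-up : {a b : Level} {A : W → Set a} {B : W → Set b} →
      (∀ {w w'} → w ≤ w' → ∀ u' → R w' u' → Σ (W × W) λ u → R w u × _≤oW_ P u u') →
      UpSet P A → UpSet P B → UpSet P (λ w → BoxL (R w) A B)
    boxL-up back A-up B-up w≤w' box x y xyR Ax with back w≤w' (x , y) xyR
    ... | (x₀ , y₀) , x₀y₀R , x≤x₀ , y₀≤y = B-up y₀≤y (box x₀ y₀ x₀y₀R (A-up x≤x₀ Ax))

    boxR-up : {b c' : Level} {B : W → Set b} {C : W → Set c'} →
      (∀ {w w'} → w ≤ w' → ∀ u' → R w' u' → Σ (W × W) λ u → R w u × _≤Wo_ P u u') →
      UpSet P B → UpSet P C → UpSet P (λ w → BoxR (R w) B C)
    boxR-up back B-up C-up w≤w' box x y xyR By with back w≤w' (x , y) xyR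
    ... | (x₀ , y₀) , x₀y₀R , x₀≤x , y≤y₀ = C-up x₀≤x (box x₀ y₀ x₀y₀R (B-up y≤y₀ By))

  module _ {r a a' b b' : Level} {R : W × W → Set r}
           {A : W → Set a} {A' : W → Set a'} {B : W → Set b} {B' : W → Set b'}
           (A-up : UpSet P A) (B-up : UpSet P B) (A≐A' : A ≐ A') (B≐B' : B ≐ B') where

    diamond-transfer : Diamond R A B ⇔ Diamond (R ↓↓) A' B'
    diamond-transfer = mk⇔ forward backward
      where
      forward : Diamond R A B → Diamond (R ↓↓) A' B'
      forward (x , y , xyR , Ax , By) =
        x , y , ((x , y) , xyR , ≤-refl , ≤-refl) , to (A≐A' x) Ax , to (B≐B' y) By
      backward : Diamond (R ↓↓) A' B' → Diamond R A B
      backward (x , y , ((x' , y') , x'y'R , x≤x' , y≤y') , A'x , B'y) =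
        x' , y' , x'y'R , A-up x≤x' (from (A≐A' x) A'x) , B-up y≤y' (from (B≐B' y) B'y)

    boxL-transfer : BoxL R A B ⇔ BoxL (R ↓↑) A' B'
    boxL-transfer = mk⇔ forward backward
      where
      forward : BoxL R A B → BoxL (R ↓↑) A' B'
      forward box x y ((x' , y') , x'y'R , x≤x' , y'≤y) A'x =
        to (B≐B' y) (B-up y'≤y (box x' y' x'y'R (A-up x≤x' (from (A≐A' x) A'x))))
      backward : BoxL (R ↓↑) A' B' → BoxL R A B
      backward box x y xyR Ax =
        from (B≐B' y) (box x y ((x , y) , xyR , ≤-refl , ≤-refl) (to (A≐A' x) Ax))

    boxR-transfer : BoxR R B A ⇔ BoxR (R ↑↓) B' A'
    boxR-transfer = mk⇔ forward backward
      where
      forward : BoxR R B A → BoxR (R ↑↓) B' A'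
      forward box x y ((x' , y') , x'y'R , x'≤x , y≤y') B'y =
        to (A≐A' x) (A-up x'≤x (box x' y' x'y'R (B-up y≤y' (from (B≐B' y) B'y))))
      backward : BoxR (R ↑↓) B' A' → BoxR R B A
      backward box x y xyR By =
        from (A≐A' x) (box x y ((x , y) , xyR , ≤-refl , ≤-refl) (to (B≐B' y) By))

  module _ {ℓ ℓv : Level} (γ : Coalg P ℓ)
           (v : ℕ → W → Set ℓv) (v-up : ∀ p → UpSet P (v p)) where
    open Coalg γ

    persistent : ∀ a → UpSet P (⟦_⟧ P a quad v)
    persistent (var p)  w≤w' (lift s) = lift (v-up p w≤w' s)
    persistent (a ∧ᶠ b) w≤w' (s , t)  = persistent a w≤w' s , persistent b w≤w' t
    persistent (a ∨ᶠ b) w≤w' (inj₁ s) = inj₁ (persistent a w≤w' s)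
    persistent (a ∨ᶠ b) w≤w' (inj₂ t) = inj₂ (persistent b w≤w' t)
    persistent ⊤ᶠ       w≤w' s        = s
    persistent Iᶠ {w} {w'} w≤w' (lift γ₁w≡0) =
      lift (zero-top (subst (_≤₂ γ₁ w') γ₁w≡0 (mono₁ w≤w')))
    persistent (a ⊗ᶠ b) = diamond-up γ⊗ (λ w≤w' → proj₁ (mono⊗ w≤w'))
                            (persistent a) (persistent b)
    persistent (a ＼ᶠ b) = boxL-up γ＼ (λ w≤w' → proj₂ (mono＼ w≤w'))
                            (persistent a) (persistent b)
    persistent (a ／ᶠ b) = boxR-up γ／ (λ w≤w' → proj₂ (mono／ w≤w'))
                            (persistent b) (persistent a)

lemma1 : {c ℓ₁ ℓ₂ ℓ ℓv : Level} (P : Poset c ℓ₁ ℓ₂) (γ : Coalg P ℓ)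
    (v : ℕ → Poset.Carrier P → Set ℓv) → (∀ p → UpSet P (v p)) →
    ∀ (a : Fm) (w : Poset.Carrier P) →
    ⟦_⟧ P a (Coalg.quad γ) v w ⇔ ⟦_⟧ P a (Coalg.quadHat γ) v w
lemma1 P γ v v-up = agree
  where
  open Coalg γ
  up : ∀ a → UpSet P (⟦_⟧ P a quad v)
  up = persistent P γ v v-up
  agree : ∀ a → _≐_ P (⟦_⟧ P a quad v) (⟦_⟧ P a quadHat v)
  agree (var p)  w = mk⇔ (λ s → lift (lower s)) (λ s → lift (lower s))
  agree (a ∧ᶠ b) w = agree a w ×-⇔ agree b w
  agree (a ∨ᶠ b) w = agree a w ⊎-⇔ agree b w
  agree ⊤ᶠ       w = mk⇔ _ _
  agree ⊥ᶠ       w = mk⇔ (λ ()) (λ ())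
  agree Iᶠ       w = mk⇔ (λ s → lift (lower s)) (λ s → lift (lower s))
  agree (a ⊗ᶠ b) w = diamond-transfer P (up a) (up b) (agree a) (agree b)
  agree (a ＼ᶠ b) w = boxL-transfer P (up a) (up b) (agree a) (agree b)
  agree (a ／ᶠ b) w = boxR-transfer P (up a) (up b) (agree a) (agree b)
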